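{- For all integers $p,q,n,g\ge 0$, \[ [r^ps^qt^nu^{2g}]\,\Phi=\sum_{0\le b\le p-1}\left[\frac{v^{n-q-1}}{(n-q-1)!}\,\frac{y^b}{b!}\,w^{p-1-b}\,\frac{x^{q-b}}{(q-b)!}\,u^{2g}\right]\langle\Gamma\rangle , \] where $\Phi=\sum_{D\in\widehat{\mathcal D}} r^{\rho(D)}s^{\nu(D)}t^{n(D)}u^{2g(D)}$ and $\Gamma$ is the $(a,b,c,d)$-dipole series defined in the context.
   Context: A rooted dipole is a 2-cell embedding, in a closed orientable surface, of a connected loopless graph with exactly two vertices (every edge joins the two vertices; multiple edges allowed), together with a distinguished edge (root edge) and one of its endpoints (root vertex); the other vertex is the non-root vertex. For a dipole $D$, $n(D)$ is its number of edges, $m(D)$ its number of faces and $g(D)=\tfrac12(n(D)-m(D))$ the genus of the surface. The root corner is the corner at the root vertex first met when circulating counterclockwise around the root vertex starting at the root edge; the root face is the face containing the root corner. $\widehat{\mathcal D}$ is the set of rooted dipoles equipped with an additional distinguished edge (secondary edge) different from the root edge; the remaining edges are ordinary. Around the root vertex, Region 1 consists of the corners and edge-ends met when rotating counterclockwise from the root edge to the secondary edge, and Region 2 of those met rotating counterclockwise from the secondary edge to the root edge; around the non-root vertex, Region 3 consists of those met rotating counterclockwise from the root edge to the secondary edge and Region 4 of those met rotating counterclockwise from the secondary edge to the root edge. An ordinary edge is an $a$-edge if its ends lie in Regions 2 and 3, a $b$-edge if in Regions 1 and 3, a $c$-edge if in Regions 2 and 4, a $d$-edge if in Regions 1 and 4;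 $\alpha(D),\beta(D),\gamma(D),\delta(D)$ denote the numbers of such edges. The root jump $\rho(D)$ is one plus the number of edges meeting the interior of Region 1, and the non-root jump $\nu(D)$ is one plus the number of edges meeting the interior of Region 3. Marking: each corner at the root vertex lying in Region 1 is labelled $\bullet$, each lying in Region 2 is labelled $\circ$. $R(D)$ is the word over $\{\bullet,\circ\}$ of labels of root-vertex corners met on a counterclockwise boundary walk of the root face starting at the root corner. For a word $S$, $(S)$ denotes the multiset of its $\ell(S)$ cyclic shifts (a cyclic binary string). For each non-root face, the word of labels met on a counterclockwise boundary walk is defined up to cyclic shift, giving a cyclic binary string; $\Lambda(D)$ is the multiset of these over all non-root faces. There are indeterminates $g_S$ indexed by words $S$ and $f_{(S)}$ indexed by cyclic binary strings, and $f_{\Lambda(D)}=\prod_{(S)\in\Lambda(D)}f_{(S)}$. With further indeterminates $x,y,v,w,u$, \[ \Gamma=\sum_{D\in\widehat{\mathcal D}}\frac{x^{\alpha(D)+1}}{(\alpha(D)+1)!}\frac{y^{\beta(D)}}{\beta(D)!}\frac{v^{\gamma(D)+\delta(D)}}{(\gamma(D)+\delta(D))!}w^{\delta(D)}u^{2g(D)}g_{R(D)}f_{\Lambda(D)}. \] For such a series $F$, $\langle F\rangle$ denotes the series obtained by setting every $g_S$ and every $f_{(S)}$ equal to $1$. The notation $[z^k/k!]F$ means $k!\,[z^k]F$, interpreted as $0$ when $k<0$. -}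

module Defs where

open import Data.Bool using (Bool; true; false; if_then_else_; _∧_; not)
open import Data.Nat using (ℕ; zero; suc; _+_; _*_; _∸_; _<ᵇ_; _≡ᵇ_; _!)
open import Data.Nat.Properties using (_!≢0; _!*_!≢0; m*n≢0)
open import Data.Nat.DivMod using (_%_)
open import Data.List using (List; []; _∷_; map; concatMap; filterᵇ; length; foldr; upTo)
open import Data.Bool.ListAction using (any)
open import Data.Integer using (ℤ; +_; -[1+_])
open import Data.Rational using (ℚ; _/_; 0ℚ) renaming (_+_ to _+ℚ_; _*_ to _*ℚ_)

range : ℕ → ℕ → List ℕ
range a b = map (λ i → a + i) (upTo (b ∸ a))

countᵇ : {A : Set} → (A → Bool) → List A → ℕ
countᵇ P xs = length (filterᵇ P xs)

sumℚ : List ℚ → ℚ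
sumℚ = foldr _+ℚ_ 0ℚ

words : ℕ → List ℕ → List (List ℕ)
words zero    A = [] ∷ []
words (suc k) A = concatMap (λ a → map (a ∷_) (words k A)) A

distinct : List ℕ → Bool
distinct []       = true
distinct (x ∷ xs) = not (any (x ≡ᵇ_) xs) ∧ distinct xs

nth : List ℕ → ℕ → ℕ
nth []       _       = 0
nth (x ∷ xs) zero    = x
nth (x ∷ xs) (suc i) = nth xs i

-- index of first occurrence (default: length)
posOf : List ℕ → ℕ → ℕ
posOf []       e = 0
posOf (x ∷ xs) e = if x ≡ᵇ e then 0 else suc (posOf xs e)

iter : (ℕ → ℕ) → ℕ → ℕ → ℕ
iter f zero    d = d
iter f (suc i) d = f (iter f i d)

-- The edges are
-- named 0,…,N-1 in the counterclockwise order in which they are met around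
-- the root vertex starting from the root edge (so the root edge is 0).
-- The counterclockwise rotation around the non-root vertex, read starting
-- at the root edge, is the list  0 ∷ w  where w is an arrangement
-- (permutation) of 1,…,N-1.  This is a bijection between rooted dipoles
-- with N edges (up to isomorphism of rooted maps) and such words w.

dipoleWords : ℕ → List (List ℕ)
dipoleWords N = filterᵇ distinct (words (N ∸ 1) (range 1 N))

record Dipole : Set where
  constructor dip
  field
    edges : ℕ
    word  : List ℕ     -- rotation at the non-root vertex after the root edge
open Dipole public

nrRot : Dipole → List ℕ
nrRot D = 0 ∷ word D

nrPos : Dipole → ℕ → ℕ
nrPos D e = posOf (nrRot D) e

-- Darts (half-edges): d < N is the root-vertex end of edge d,
-- N + e is the non-root-vertex end of edge e.
-- σ : counterclockwise rotation at the vertices; α : edge involution.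
σ : Dipole → ℕ → ℕ
σ D d with d <ᵇ edges D
... | true  = suc d % suc (edges D ∸ 1)
... | false = edges D + nth (nrRot D) (suc (nrPos D (d ∸ edges D)) % suc (edges D ∸ 1))

αᵈ : Dipole → ℕ → ℕ
αᵈ D d = if d <ᵇ edges D then d + edges D else d ∸ edges D

φ : Dipole → ℕ → ℕ
φ D d = σ D (αᵈ D d)

-- number of faces m(D) = number of cycles of φ on the 2N darts
-- (counted as the darts that are the minimum of their φ-orbit)
faces : Dipole → ℕ
faces D = countᵇ isMin (range 0 (2 * edges D))
  where
  isMin : ℕ → Bool
  isMin d = not (any (λ i → iter (φ D) i d <ᵇ d) (range 0 (2 * edges D)))

-- rooted dipoles with N edges, all with a secondary edge k ∈ {1,…,N-1}
record DipoleHat : Set where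
  constructor dhat
  field
    base : Dipole
    sec  : ℕ
open DipoleHat public

dipolesHat : ℕ → List DipoleHat
dipolesHat N = concatMap (λ w → map (dhat (dip N w)) (range 1 N)) (dipoleWords N)

twoGenus : DipoleHat → ℕ
twoGenus X = edges (base X) ∸ faces (base X)

-- An edge end at the root vertex (edge e, 0 < e ≠ k) is in
-- Region 1 iff e < k (strictly between root and secondary edge ccw),
-- otherwise Region 2.  At the non-root vertex it is in Region 3 iff
-- its position is strictly before that of the secondary edge, else Region 4.
inR1 : DipoleHat → ℕ → Bool
inR1 X e = (0 <ᵇ e) ∧ (e <ᵇ sec X)

inR3 : DipoleHat → ℕ → Bool
inR3 X e = (0 <ᵇ nrPos (base X) e) ∧ (nrPos (base X) e <ᵇ nrPos (base X) (sec X))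

ordinaryEdges : DipoleHat → List ℕ
ordinaryEdges X = filterᵇ (λ e → not (e ≡ᵇ sec X)) (range 1 (edges (base X)))

allEdges : DipoleHat → List ℕ
allEdges X = range 0 (edges (base X))

ρ : DipoleHat → ℕ
ρ X = suc (countᵇ (inR1 X) (allEdges X))

ν : DipoleHat → ℕ
ν X = suc (countᵇ (inR3 X) (allEdges X))

αE βE γE δE : DipoleHat → ℕ
αE X = countᵇ (λ e → not (inR1 X e) ∧ inR3 X e)       (ordinaryEdges X)
βE X = countᵇ (λ e → inR1 X e ∧ inR3 X e)             (ordinaryEdges X)
γE X = countᵇ (λ e → not (inR1 X e) ∧ not (inR3 X e)) (ordinaryEdges X)
δE X = countᵇ (λ e → inR1 X e ∧ not (inR3 X e))       (ordinaryEdges X)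

phiCoeff : ℕ → ℕ → ℕ → ℕ → ℕ
phiCoeff p q n g =
  countᵇ (λ X → (ρ X ≡ᵇ p) ∧ (ν X ≡ᵇ q) ∧ (twoGenus X ≡ᵇ 2 * g)) (dipolesHat n)

invFact3 : ℕ → ℕ → ℕ → ℚ
invFact3 a b c = _/_ (+ 1) (a ! * b ! * c !) {{m*n≢0 _ _ {{a !* b !≢0}} {{c !≢0}}}}

-- A dipole D in 𝒟̂ contributes to this monomial only if
-- α+1 = ex, β = ey, γ+δ = ev, so n(D) = 2+α+β+γ+δ = ex+ey+ev+1;
-- hence only dipoles with that many edges are summed over.
gammaCoeff : (ex ey ev ew eu : ℕ) → ℚ
gammaCoeff ex ey ev ew eu =
  sumℚ (map term (dipolesHat (ex + ey + ev + 1)))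
  where
  term : DipoleHat → ℚ
  term X =
    if (suc (αE X) ≡ᵇ ex) ∧ (βE X ≡ᵇ ey) ∧ (γE X + δE X ≡ᵇ ev)
       ∧ (δE X ≡ᵇ ew) ∧ (twoGenus X ≡ᵇ eu)
    then invFact3 (suc (αE X)) (βE X) (γE X + δE X)
    else 0ℚ

-- [ v^a/a! · y^b/b! · w^c · x^d/d! · u^e ] ⟨Γ⟩ ,
-- i.e. a! b! d! [v^a y^b w^c x^d u^e] ⟨Γ⟩ ; zero when a < 0 or d < 0.
bracketΓ : (a : ℤ) (b c : ℕ) (d : ℤ) (e : ℕ) → ℚ
bracketΓ (+ a)    b c (+ d)    e =
  ((+ (a ! * b ! * d !)) / 1) *ℚ gammaCoeff d b a c e
bracketΓ (+ a)    b c -[1+ d ] e = 0ℚ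
bracketΓ -[1+ a ] b c d        e = 0ℚ

-- Every ordinary edge of a dipole in 𝒟̂ is of exactly one of the types a, b, c, d, and the
-- jumps are read off these types: ρ = 1 + β + δ and ν = 1 + α + β, while n = α + β + γ + δ + 2.
-- Hence, after splitting the dipoles counted by [r^p s^q t^n u^2g] Φ according to their number
-- b < p of b-edges, the remaining types are forced: α + 1 = q − b, δ = p − 1 − b and
-- γ + δ = n − q − 1.  Each class is therefore exactly the set of dipoles contributing to one
-- monomial of ⟨Γ⟩, and the factorials in the bracket cancel the exponential weights.  Classes
-- for which q − b or n − q − 1 would be negative are empty, matching the convention
-- [z^k/k!] F = 0 for k < 0.
module Submission where

open import Defs
open import Data.Nat using (ℕ; _∸_)
open import Data.Integer using (+_) renaming (_-_ to _-ℤ_)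
open import Data.List using (map; upTo)
open import Data.Rational using (_/_)
open import Relation.Binary.PropositionalEquality using (_≡_)

open import Data.Bool using (Bool; true; false; T; _∧_; not; if_then_else_)
open import Data.Bool.Properties using (∧-zeroʳ)
open import Data.Integer using (-[1+_]) renaming (_+_ to _+ℤ_; _*_ to _*ℤ_; -_ to -ℤ_)
import Data.Integer.Properties as ℤ
open import Data.List using (List; []; _∷_; length; filterᵇ; applyUpTo)
open import Data.List.Properties using (length-map; length-upTo; map-applyUpTo; map-cong-local)
open import Data.List.Relation.Unary.All using (All; []; _∷_; universal) renaming (map to All-map)
open import Data.List.Relation.Unary.All.Properties using (concat⁺; map⁺; applyUpTo⁺₁)
open import Data.Nat using (zero; suc; _+_; _*_; _!; _≤_; _<_; _≡ᵇ_; _<ᵇ_; s≤s; NonZero)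
open import Data.Nat.ListAction using (sum)
open import Data.Nat.Properties
  using (_≟_; ≡ᵇ⇒≡; +-commutativeSemigroup; *-commutativeSemigroup; _!≢0; _!*_!≢0; m*n≢0;
         +-comm; +-suc; +-cancelˡ-≡; suc-injective; m≤m+n; m≤n+m; m+n∸m≡n;
         ≤-<-connex; m≤n⇒∃[o]m+o≡n; <⇒≱; <-irrefl; <-trans)
open import Data.Nat.Tactic.RingSolver using (solve-∀)
open import Data.Product using (_×_; _,_; proj₁)
open import Data.Rational using (ℚ; 0ℚ; 1ℚ; fromℚᵘ) renaming (_+_ to _+ℚ_; _*_ to _*ℚ_)
import Data.Rational.Properties as ℚ
open import Algebra.Bundles using (CommutativeMonoid)
import Algebra.Properties.CommutativeSemigroup as CommSemigroupProperties
open import Data.Rational.Unnormalised using (mkℚᵘ; *≡*)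
  renaming (_+_ to _+ᵘ_; _*_ to _*ᵘ_)
import Data.Rational.Unnormalised.Properties as ℚᵘ
open import Data.Sum using (_⊎_; inj₁; inj₂)
open import Function using (_∘_; _⇔_; mk⇔)
open import Relation.Binary.PropositionalEquality using (refl; sym; trans; cong; cong₂; subst; subst₂; module ≡-Reasoning)
open import Relation.Nullary using (Dec; _because_; does; ofʸ; _×-dec_)
open import Relation.Nullary.Decidable using (dec-false; does-⇔)

open ≡-Reasoning

module ℕ+ = CommSemigroupProperties +-commutativeSemigroup
module ℕ* = CommSemigroupProperties *-commutativeSemigroup
module ℚ* = CommSemigroupProperties (CommutativeMonoid.commutativeSemigroup ℚ.*-1-commutativeMonoid)

ℕtoℚ : ℕ → ℚ
ℕtoℚ n = + n / 1

fromℚᵘ-homo-+ : ∀ p q → fromℚᵘ (p +ᵘ q) ≡ fromℚᵘ p +ℚ fromℚᵘ q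
fromℚᵘ-homo-+ p q = ℚ.toℚᵘ-injective
  (ℚᵘ.≃-trans (ℚ.toℚᵘ-fromℚᵘ (p +ᵘ q))
  (ℚᵘ.≃-trans (ℚᵘ.+-cong (ℚᵘ.≃-sym (ℚ.toℚᵘ-fromℚᵘ p)) (ℚᵘ.≃-sym (ℚ.toℚᵘ-fromℚᵘ q)))
              (ℚᵘ.≃-sym (ℚ.toℚᵘ-homo-+ (fromℚᵘ p) (fromℚᵘ q)))))

fromℚᵘ-homo-* : ∀ p q → fromℚᵘ (p *ᵘ q) ≡ fromℚᵘ p *ℚ fromℚᵘ q
fromℚᵘ-homo-* p q = ℚ.toℚᵘ-injective
  (ℚᵘ.≃-trans (ℚ.toℚᵘ-fromℚᵘ (p *ᵘ q))
  (ℚᵘ.≃-trans (ℚᵘ.*-cong (ℚᵘ.≃-sym (ℚ.toℚᵘ-fromℚᵘ p)) (ℚᵘ.≃-sym (ℚ.toℚᵘ-fromℚᵘ q)))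
              (ℚᵘ.≃-sym (ℚ.toℚᵘ-homo-* (fromℚᵘ p) (fromℚᵘ q)))))

ℕtoℚ-homo-+ : (m n : ℕ) → ℕtoℚ (m + n) ≡ ℕtoℚ m +ℚ ℕtoℚ n
ℕtoℚ-homo-+ m n =
  trans (ℚ.fromℚᵘ-cong {mkℚᵘ (+ (m + n)) 0} {mkℚᵘ (+ m) 0 +ᵘ mkℚᵘ (+ n) 0} (*≡* cross))
        (fromℚᵘ-homo-+ (mkℚᵘ (+ m) 0) (mkℚᵘ (+ n) 0))
  where
  cross : + (m + n) *ℤ + 1 ≡ (+ m *ℤ + 1 +ℤ + n *ℤ + 1) *ℤ + 1
  cross rewrite ℤ.*-identityʳ (+ m) | ℤ.*-identityʳ (+ n) | ℤ.*-identityʳ (+ m +ℤ + n)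
              = ℤ.pos-+ m n

ℕtoℚ-*-inverse : ∀ m .{{_ : NonZero m}} → ℕtoℚ m *ℚ (+ 1 / m) ≡ 1ℚ
ℕtoℚ-*-inverse (suc m) =
  trans (sym (fromℚᵘ-homo-* (mkℚᵘ (+ suc m) 0) (mkℚᵘ (+ 1) m)))
        (ℚ.fromℚᵘ-cong {mkℚᵘ (+ suc m) 0 *ᵘ mkℚᵘ (+ 1) m} {mkℚᵘ (+ 1) 0} (*≡* cross))
  where
  unit : ∀ k → k * 1 * 1 ≡ k + 0 + 0
  unit = solve-∀
  cross : + suc m *ℤ + 1 *ℤ + 1 ≡ + 1 *ℤ + (1 * suc m)
  cross = cong (λ k → + suc k) (unit m)

ℕtoℚ-sum : {A : Set} (f : A → ℕ) (xs : List A) →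
           ℕtoℚ (sum (map f xs)) ≡ sumℚ (map (ℕtoℚ ∘ f) xs)
ℕtoℚ-sum f []       = refl
ℕtoℚ-sum f (x ∷ xs) = trans (ℕtoℚ-homo-+ (f x) (sum (map f xs))) (cong (ℕtoℚ (f x) +ℚ_) (ℕtoℚ-sum f xs))

boolToℕ : Bool → ℕ
boolToℕ true  = 1
boolToℕ false = 0

T-does : {A : Set} (a? : Dec A) → T (does a?) → A
T-does (true because ofʸ a) _ = a

module _ {A : Set} where

  countᵇ-∷ : (P : A → Bool) (x : A) (xs : List A) → countᵇ P (x ∷ xs) ≡ boolToℕ (P x) + countᵇ P xs
  countᵇ-∷ P x xs with P x
  ... | true  = refl
  ... | false = refl

  countᵇ-cong : {P Q : A → Bool} {xs : List A} → All (λ x → P x ≡ Q x) xs → countᵇ P xs ≡ countᵇ Q xs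
  countᵇ-cong {P} {Q} {[]}     []         = refl
  countᵇ-cong {P} {Q} {x ∷ xs} (Px≡Qx ∷ eqs) = begin
    countᵇ P (x ∷ xs)               ≡⟨ countᵇ-∷ P x xs ⟩
    boolToℕ (P x) + countᵇ P xs     ≡⟨ cong₂ (λ b n → boolToℕ b + n) Px≡Qx (countᵇ-cong eqs) ⟩
    boolToℕ (Q x) + countᵇ Q xs     ≡⟨ sym (countᵇ-∷ Q x xs) ⟩
    countᵇ Q (x ∷ xs)               ∎

  countᵇ-none : (P : A → Bool) (xs : List A) → All (λ x → P x ≡ false) xs → countᵇ P xs ≡ 0
  countᵇ-none P []       []           = refl
  countᵇ-none P (x ∷ xs) (Px≡false ∷ h) =
    trans (countᵇ-∷ P x xs) (trans (cong (λ b → boolToℕ b + countᵇ P xs) Px≡false) (countᵇ-none P xs h))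

  countᵇ-+ : (P Q R : A → Bool) (xs : List A) → (∀ x → boolToℕ (P x) + boolToℕ (Q x) ≡ boolToℕ (R x)) →
             countᵇ P xs + countᵇ Q xs ≡ countᵇ R xs
  countᵇ-+ P Q R []       h = refl
  countᵇ-+ P Q R (x ∷ xs) h = begin
    countᵇ P (x ∷ xs) + countᵇ Q (x ∷ xs)
      ≡⟨ cong₂ _+_ (countᵇ-∷ P x xs) (countᵇ-∷ Q x xs) ⟩
    (boolToℕ (P x) + countᵇ P xs) + (boolToℕ (Q x) + countᵇ Q xs)
      ≡⟨ ℕ+.interchange (boolToℕ (P x)) (countᵇ P xs) (boolToℕ (Q x)) (countᵇ Q xs) ⟩
    (boolToℕ (P x) + boolToℕ (Q x)) + (countᵇ P xs + countᵇ Q xs)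
      ≡⟨ cong₂ _+_ (h x) (countᵇ-+ P Q R xs h) ⟩
    boolToℕ (R x) + countᵇ R xs
      ≡⟨ sym (countᵇ-∷ R x xs) ⟩
    countᵇ R (x ∷ xs) ∎

  countᵇ-complement : (P : A → Bool) (xs : List A) → countᵇ P xs + countᵇ (not ∘ P) xs ≡ length xs
  countᵇ-complement P []       = refl
  countᵇ-complement P (x ∷ xs) with P x
  ... | true  = cong suc (countᵇ-complement P xs)
  ... | false = trans (+-suc (countᵇ P xs) _) (cong suc (countᵇ-complement P xs))

  countᵇ-filterᵇ : (P Q : A → Bool) (xs : List A) →
                   countᵇ P (filterᵇ Q xs) ≡ countᵇ (λ x → Q x ∧ P x) xs
  countᵇ-filterᵇ P Q []       = refl
  countᵇ-filterᵇ P Q (x ∷ xs) with Q x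
  ... | false = countᵇ-filterᵇ P Q xs
  ... | true with P x
  ...   | true  = cong suc (countᵇ-filterᵇ P Q xs)
  ...   | false = countᵇ-filterᵇ P Q xs

  sum-boolToℕ : (P : A → Bool) (xs : List A) → sum (map (boolToℕ ∘ P) xs) ≡ countᵇ P xs
  sum-boolToℕ P []       = refl
  sum-boolToℕ P (x ∷ xs) = trans (cong (λ n → boolToℕ (P x) + n) (sum-boolToℕ P xs)) (sym (countᵇ-∷ P x xs))

  sum-zero : (xs : List A) → sum (map (λ _ → 0) xs) ≡ 0
  sum-zero []       = refl
  sum-zero (x ∷ xs) = sum-zero xs

  sum-map-+ : (f g : A → ℕ) (xs : List A) → sum (map (λ x → f x + g x) xs) ≡ sum (map f xs) + sum (map g xs)
  sum-map-+ f g []       = refl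
  sum-map-+ f g (x ∷ xs) = trans (cong (λ n → f x + g x + n) (sum-map-+ f g xs)) (ℕ+.interchange (f x) (g x) _ _)

countᵇ-map : {A B : Set} (P : B → Bool) (f : A → B) (xs : List A) →
             countᵇ P (map f xs) ≡ countᵇ (P ∘ f) xs
countᵇ-map P f []       = refl
countᵇ-map P f (x ∷ xs) = trans (countᵇ-∷ P (f x) (map f xs))
  (trans (cong (λ n → boolToℕ (P (f x)) + n) (countᵇ-map P f xs)) (sym (countᵇ-∷ (P ∘ f) x xs)))

countᵇ-applyUpTo-suc : (P : ℕ → Bool) (n : ℕ) → countᵇ P (applyUpTo suc n) ≡ countᵇ (P ∘ suc) (upTo n)
countᵇ-applyUpTo-suc P n = trans (cong (countᵇ P) (sym (map-applyUpTo (λ i → i) suc n))) (countᵇ-map P suc (upTo n))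

countᵇ-upTo-≡ᵇ : ∀ {m p} → m < p → countᵇ (_≡ᵇ m) (upTo p) ≡ 1
countᵇ-upTo-≡ᵇ {zero}  {suc p} _ =
  cong suc (trans (countᵇ-applyUpTo-suc (_≡ᵇ 0) p) (countᵇ-none _ (upTo p) (universal (λ _ → refl) _)))
countᵇ-upTo-≡ᵇ {suc m} {suc p} (s≤s m<p) =
  trans (countᵇ-applyUpTo-suc (_≡ᵇ suc m) p) (countᵇ-upTo-≡ᵇ m<p)

countᵇ-fibres : {A : Set} (P : A → Bool) (f : A → ℕ) (p : ℕ) (xs : List A) → (∀ x → T (P x) → f x < p) →
                countᵇ P xs ≡ sum (map (λ b → countᵇ (λ x → P x ∧ (b ≡ᵇ f x)) xs) (upTo p))
countᵇ-fibres P f p []       bound = sym (sum-zero (upTo p))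
countᵇ-fibres P f p (x ∷ xs) bound = begin
  countᵇ P (x ∷ xs)
    ≡⟨ countᵇ-∷ P x xs ⟩
  boolToℕ (P x) + countᵇ P xs
    ≡⟨ cong₂ _+_ (sym (indicatorAt (P x) (bound x))) (countᵇ-fibres P f p xs bound) ⟩
  sum (map (λ b → boolToℕ (fibre b x)) (upTo p)) + sum (map (λ b → countᵇ (fibre b) xs) (upTo p))
    ≡⟨ sym (sum-map-+ (λ b → boolToℕ (fibre b x)) (λ b → countᵇ (fibre b) xs) (upTo p)) ⟩
  sum (map (λ b → boolToℕ (fibre b x) + countᵇ (fibre b) xs) (upTo p))
    ≡⟨ cong sum (map-cong-local (universal (λ b → sym (countᵇ-∷ (fibre b) x xs)) (upTo p))) ⟩
  sum (map (λ b → countᵇ (fibre b) (x ∷ xs)) (upTo p)) ∎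
  where
  fibre : ℕ → _ → Bool
  fibre b y = P y ∧ (b ≡ᵇ f y)
  indicatorAt : ∀ c → (T c → f x < p) → sum (map (λ b → boolToℕ (c ∧ (b ≡ᵇ f x))) (upTo p)) ≡ boolToℕ c
  indicatorAt true  h = trans (sum-boolToℕ (_≡ᵇ f x) (upTo p)) (countᵇ-upTo-≡ᵇ (h _))
  indicatorAt false h = sum-zero (upTo p)

sumℚ-if : {A : Set} (P : A → Bool) (f : A → ℚ) (K : ℚ) (xs : List A) → (∀ x → T (P x) → f x ≡ K) →
          sumℚ (map (λ x → if P x then f x else 0ℚ) xs) ≡ ℕtoℚ (countᵇ P xs) *ℚ K
sumℚ-if P f K []       h = sym (ℚ.*-zeroˡ K)
sumℚ-if P f K (x ∷ xs) h = begin
  (if P x then f x else 0ℚ) +ℚ sumℚ (map (λ y → if P y then f y else 0ℚ) xs)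
    ≡⟨ cong₂ _+ℚ_ (ifAsProduct (P x) (h x)) (sumℚ-if P f K xs h) ⟩
  ℕtoℚ (boolToℕ (P x)) *ℚ K +ℚ ℕtoℚ (countᵇ P xs) *ℚ K
    ≡⟨ sym (ℚ.*-distribʳ-+ K (ℕtoℚ (boolToℕ (P x))) (ℕtoℚ (countᵇ P xs))) ⟩
  (ℕtoℚ (boolToℕ (P x)) +ℚ ℕtoℚ (countᵇ P xs)) *ℚ K
    ≡⟨ cong (_*ℚ K) (sym (ℕtoℚ-homo-+ (boolToℕ (P x)) (countᵇ P xs))) ⟩
  ℕtoℚ (boolToℕ (P x) + countᵇ P xs) *ℚ K
    ≡⟨ cong (λ n → ℕtoℚ n *ℚ K) (sym (countᵇ-∷ P x xs)) ⟩
  ℕtoℚ (countᵇ P (x ∷ xs)) *ℚ K ∎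
  where
  ifAsProduct : ∀ c {y} → (T c → y ≡ K) → (if c then y else 0ℚ) ≡ ℕtoℚ (boolToℕ c) *ℚ K
  ifAsProduct true  y≡K = trans (y≡K _) (sym (ℚ.*-identityˡ K))
  ifAsProduct false _   = sym (ℚ.*-zeroˡ K)

<ᵇ-irreflʳ-∧ : ∀ b m → (b ∧ (m <ᵇ m)) ≡ false
<ᵇ-irreflʳ-∧ b zero    = ∧-zeroʳ b
<ᵇ-irreflʳ-∧ b (suc m) = <ᵇ-irreflʳ-∧ b m

boolToℕ-∧-split : ∀ a b → boolToℕ (a ∧ b) + boolToℕ (a ∧ not b) ≡ boolToℕ a
boolToℕ-∧-split true  true  = refl
boolToℕ-∧-split true  false = refl
boolToℕ-∧-split false b     = refl

boolToℕ-∧-splitˡ : ∀ a b → boolToℕ (not a ∧ b) + boolToℕ (a ∧ b) ≡ boolToℕ b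
boolToℕ-∧-splitˡ true  b     = refl
boolToℕ-∧-splitˡ false true  = refl
boolToℕ-∧-splitˡ false false = refl

countᵇ-range-0 : (P : ℕ → Bool) (N : ℕ) → P 0 ≡ false → countᵇ P (range 0 N) ≡ countᵇ P (range 1 N)
countᵇ-range-0 P zero    _        = refl
countᵇ-range-0 P (suc N) P0≡false = begin
  countᵇ P (range 0 (suc N))                  ≡⟨ countᵇ-map P (λ i → 0 + i) (upTo (suc N)) ⟩
  countᵇ P (upTo (suc N))                     ≡⟨ countᵇ-∷ P 0 (applyUpTo suc N) ⟩
  boolToℕ (P 0) + countᵇ P (applyUpTo suc N)  ≡⟨ cong (λ b → boolToℕ b + countᵇ P (applyUpTo suc N)) P0≡false ⟩
  countᵇ P (applyUpTo suc N)                  ≡⟨ countᵇ-applyUpTo-suc P N ⟩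
  countᵇ (P ∘ suc) (upTo N)                   ≡⟨ sym (countᵇ-map P (λ i → 1 + i) (upTo N)) ⟩
  countᵇ P (range 1 (suc N))                  ∎

countᵇ-allEdges : (X : DipoleHat) (P : ℕ → Bool) → P 0 ≡ false → P (sec X) ≡ false →
                  countᵇ P (allEdges X) ≡ countᵇ P (ordinaryEdges X)
countᵇ-allEdges X P P0≡false Psec≡false = begin
  countᵇ P (range 0 N)                                ≡⟨ countᵇ-range-0 P N P0≡false ⟩
  countᵇ P (range 1 N)                                ≡⟨ countᵇ-cong (universal offSecondary (range 1 N)) ⟨
  countᵇ (λ e → not (e ≡ᵇ sec X) ∧ P e) (range 1 N)   ≡⟨ countᵇ-filterᵇ P (λ e → not (e ≡ᵇ sec X)) (range 1 N) ⟨
  countᵇ P (ordinaryEdges X)                          ∎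
  where
  N = edges (base X)
  offSecondary : ∀ e → (not (e ≡ᵇ sec X) ∧ P e) ≡ P e
  offSecondary e with e ≡ᵇ sec X in e≡ᵇsec
  ... | false = refl
  ... | true  = trans (sym Psec≡false) (cong P (sym (≡ᵇ⇒≡ e (sec X) (subst T (sym e≡ᵇsec) _))))

ρ≡1+β+δ : ∀ X → ρ X ≡ suc (βE X + δE X)
ρ≡1+β+δ X = cong suc (begin
  countᵇ (inR1 X) (allEdges X)
    ≡⟨ countᵇ-allEdges X (inR1 X) refl (<ᵇ-irreflʳ-∧ (0 <ᵇ sec X) (sec X)) ⟩
  countᵇ (inR1 X) (ordinaryEdges X)
    ≡⟨ countᵇ-+ _ _ (inR1 X) (ordinaryEdges X) (λ e → boolToℕ-∧-split (inR1 X e) (inR3 X e)) ⟨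
  βE X + δE X ∎)

ν≡1+α+β : ∀ X → ν X ≡ suc (αE X + βE X)
ν≡1+α+β X = cong suc (begin
  countᵇ (inR3 X) (allEdges X)
    ≡⟨ countᵇ-allEdges X (inR3 X) refl (<ᵇ-irreflʳ-∧ _ (nrPos (base X) (sec X))) ⟩
  countᵇ (inR3 X) (ordinaryEdges X)
    ≡⟨ countᵇ-+ _ _ (inR3 X) (ordinaryEdges X) (λ e → boolToℕ-∧-splitˡ (inR1 X e) (inR3 X e)) ⟨
  αE X + βE X ∎)

ordinaryEdges-classes : ∀ X → (αE X + βE X) + (γE X + δE X) ≡ length (ordinaryEdges X)
ordinaryEdges-classes X = trans
  (cong₂ _+_ (countᵇ-+ _ _ (inR3 X) (ordinaryEdges X) (λ e → boolToℕ-∧-splitˡ (inR1 X e) (inR3 X e)))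
             (countᵇ-+ _ _ (not ∘ inR3 X) (ordinaryEdges X) (λ e → boolToℕ-∧-splitˡ (inR1 X e) (not (inR3 X e)))))
  (countᵇ-complement (inR3 X) (ordinaryEdges X))

length-ordinaryEdges : ∀ N w k → k < N ∸ 1 → 2 + length (ordinaryEdges (dhat (dip N w) (suc k))) ≡ N
length-ordinaryEdges (suc N) w k k<N = cong suc (begin
  1 + L                       ≡⟨ cong (λ c → c + L) secondaryOnce ⟨
  countᵇ (_≡ᵇ suc k) R + L    ≡⟨ countᵇ-complement (_≡ᵇ suc k) R ⟩
  length R                    ≡⟨ length-map (λ i → 1 + i) (upTo N) ⟩
  length (upTo N)             ≡⟨ length-upTo N ⟩
  N                           ∎)
  where
  R = range 1 (suc N)
  L = length (ordinaryEdges (dhat (dip (suc N) w) (suc k)))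
  secondaryOnce : countᵇ (_≡ᵇ suc k) R ≡ 1
  secondaryOnce = trans (countᵇ-map (_≡ᵇ suc k) (λ i → 1 + i) (upTo N)) (countᵇ-upTo-≡ᵇ k<N)

dipolesHat-classes : ∀ N → All (λ X → 2 + ((αE X + βE X) + (γE X + δE X)) ≡ N) (dipolesHat N)
dipolesHat-classes N =
  concat⁺ (map⁺ (universal (λ w → map⁺ (map⁺ (applyUpTo⁺₁ (λ k → k) (N ∸ 1) (classes w)))) (dipoleWords N)))
  where
  classes : ∀ w {k} → k < N ∸ 1 → let X = dhat (dip N w) (suc k) in 2 + ((αE X + βE X) + (γE X + δE X)) ≡ N
  classes w {k} k<N = trans (cong (λ c → 2 + c) (ordinaryEdges-classes (dhat (dip N w) (suc k))))
                            (length-ordinaryEdges N w k k<N)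

[+[m+n]]-[+m]≡+n : ∀ m n → + (m + n) -ℤ + m ≡ + n
[+[m+n]]-[+m]≡+n m n = trans (ℤ.[+m]-[+n]≡m⊖n (m + n) m) (trans (ℤ.⊖-≥ (m≤m+n m n)) (cong +_ (m+n∸m≡n m n)))

[+m]-[+[1+m+n]]≡-[1+n] : ∀ m n → + m -ℤ + suc (m + n) ≡ -[1+ n ]
[+m]-[+[1+m+n]]≡-[1+n] m n = trans (ℤ.[+m]-[+n]≡m⊖n m (suc (m + n)))
  (trans (ℤ.⊖-< (s≤s (m≤m+n m n))) (cong (λ k → -ℤ + k) (trans (cong (_∸ m) (sym (+-suc m n))) (m+n∸m≡n m (suc n)))))

i-[+m]-1≡i-[+[1+m]] : ∀ i m → i -ℤ + m -ℤ + 1 ≡ i -ℤ + suc m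
i-[+m]-1≡i-[+[1+m]] i m = begin
  i +ℤ -ℤ + m +ℤ -ℤ + 1     ≡⟨ ℤ.+-assoc i (-ℤ + m) (-ℤ + 1) ⟩
  i +ℤ (-ℤ + m +ℤ -ℤ + 1)   ≡⟨ cong (i +ℤ_) (ℤ.neg-distrib-+ (+ m) (+ 1)) ⟨
  i +ℤ -ℤ (+ m +ℤ + 1)      ≡⟨ cong (λ k → i +ℤ -ℤ k) (ℤ.pos-+ m 1) ⟨
  i +ℤ -ℤ + (m + 1)         ≡⟨ cong (λ k → i -ℤ + k) (+-comm m 1) ⟩
  i -ℤ + suc m              ∎

Exponents : (ex ey ev ew eu : ℕ) → DipoleHat → Set
Exponents ex ey ev ew eu X =
  suc (αE X) ≡ ex × βE X ≡ ey × γE X + δE X ≡ ev × δE X ≡ ew × twoGenus X ≡ eu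

exponents? : ∀ ex ey ev ew eu X → Dec (Exponents ex ey ev ew eu X)
exponents? ex ey ev ew eu X =
  suc (αE X) ≟ ex ×-dec βE X ≟ ey ×-dec γE X + δE X ≟ ev ×-dec δE X ≟ ew ×-dec twoGenus X ≟ eu

monomialCount : (ex ey ev ew eu : ℕ) → ℕ
monomialCount ex ey ev ew eu =
  countᵇ (λ X → does (exponents? ex ey ev ew eu X)) (dipolesHat (ex + ey + ev + 1))

gammaCoeff≡monomialCount : ∀ ex ey ev ew eu →
  gammaCoeff ex ey ev ew eu ≡ ℕtoℚ (monomialCount ex ey ev ew eu) *ℚ invFact3 ex ey ev
gammaCoeff≡monomialCount ex ey ev ew eu =
  sumℚ-if (λ X → does (exponents? ex ey ev ew eu X)) (λ X → invFact3 (suc (αE X)) (βE X) (γE X + δE X))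
          (invFact3 ex ey ev) (dipolesHat (ex + ey + ev + 1))
          (λ X → weight {X} ∘ T-does (exponents? ex ey ev ew eu X))
  where
  weight : ∀ {X} → Exponents ex ey ev ew eu X → invFact3 (suc (αE X)) (βE X) (γE X + δE X) ≡ invFact3 ex ey ev
  weight (refl , refl , refl , _) = refl

bracketΓ≡monomialCount : ∀ a b c d e → bracketΓ (+ a) b c (+ d) e ≡ ℕtoℚ (monomialCount d b a c e)
bracketΓ≡monomialCount a b c d e = begin
  ℕtoℚ (a ! * b ! * d !) *ℚ gammaCoeff d b a c e
    ≡⟨ cong (ℕtoℚ (a ! * b ! * d !) *ℚ_) (gammaCoeff≡monomialCount d b a c e) ⟩
  ℕtoℚ (a ! * b ! * d !) *ℚ (ℕtoℚ k *ℚ invFact3 d b a)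
    ≡⟨ ℚ*.x∙yz≈y∙xz (ℕtoℚ (a ! * b ! * d !)) (ℕtoℚ k) (invFact3 d b a) ⟩
  ℕtoℚ k *ℚ (ℕtoℚ (a ! * b ! * d !) *ℚ invFact3 d b a)
    ≡⟨ cong (λ m → ℕtoℚ k *ℚ (ℕtoℚ m *ℚ invFact3 d b a)) (ℕ*.xy∙z≈zy∙x (a !) (b !) (d !)) ⟩
  ℕtoℚ k *ℚ (ℕtoℚ (d ! * b ! * a !) *ℚ invFact3 d b a)
    ≡⟨ cong (ℕtoℚ k *ℚ_) (ℕtoℚ-*-inverse (d ! * b ! * a !) {{m*n≢0 _ _ {{d !* b !≢0}} {{a !≢0}}}}) ⟩
  ℕtoℚ k *ℚ 1ℚ
    ≡⟨ ℚ.*-identityʳ (ℕtoℚ k) ⟩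
  ℕtoℚ k ∎
  where
  k = monomialCount d b a c e

Jumps : (p q g : ℕ) → DipoleHat → Set
Jumps p q g X = ρ X ≡ p × ν X ≡ q × twoGenus X ≡ 2 * g

jumps? : ∀ p q g X → Dec (Jumps p q g X)
jumps? p q g X = ρ X ≟ p ×-dec ν X ≟ q ×-dec twoGenus X ≟ 2 * g

-- Written b ≟ βE X, so that `does` of it is literally the fibre predicate of countᵇ-fibres.
fibre? : ∀ p q g b X → Dec (Jumps p q g X × b ≡ βE X)
fibre? p q g b X = jumps? p q g X ×-dec b ≟ βE X

fibreCount : (p q n g b : ℕ) → ℕ
fibreCount p q n g b = countᵇ (λ X → does (fibre? p q g b X)) (dipolesHat n)

module _ {α β γ δ ρ ν b p′ q′ n′ : ℕ} {G : Set} where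

  jumps⇒exponents : ρ ≡ suc (β + δ) → ν ≡ suc (α + β) → 2 + ((α + β) + (γ + δ)) ≡ suc (b + q′ + n′) →
                    (ρ ≡ suc b + p′ × ν ≡ b + q′ × G) × b ≡ β →
                    suc α ≡ q′ × β ≡ b × γ + δ ≡ n′ × δ ≡ p′ × G
  jumps⇒exponents refl refl n≡ ((ρ≡p , ν≡q , g) , refl) = α≡ , refl , γ+δ≡ , δ≡ , g
    where
    δ≡ : δ ≡ p′
    δ≡ = +-cancelˡ-≡ β δ p′ (suc-injective ρ≡p)
    α≡ : suc α ≡ q′
    α≡ = +-cancelˡ-≡ β (suc α) q′ (trans (trans (+-suc β α) (cong suc (+-comm β α))) ν≡q)
    γ+δ≡ : γ + δ ≡ n′
    γ+δ≡ = +-cancelˡ-≡ (suc (β + suc α)) (γ + δ) n′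
      (trans (regroup α β (γ + δ)) (subst (λ x → _ ≡ suc (β + x + n′)) (sym α≡) n≡))
      where
      regroup : ∀ a c x → suc (c + suc a) + x ≡ 2 + ((a + c) + x)
      regroup = solve-∀

  exponents⇒jumps : ρ ≡ suc (β + δ) → ν ≡ suc (α + β) →
                    suc α ≡ q′ × β ≡ b × γ + δ ≡ n′ × δ ≡ p′ × G →
                    (ρ ≡ suc b + p′ × ν ≡ b + q′ × G) × b ≡ β
  exponents⇒jumps refl refl (refl , refl , _ , refl , g) = (refl , regroup α β , g) , refl
    where
    regroup : ∀ a c → suc (a + c) ≡ c + suc a
    regroup = solve-∀

fibreCount≡monomialCount : ∀ b p′ q′ n′ g →
  fibreCount (suc b + p′) (b + q′) (suc (b + q′ + n′)) g b ≡ monomialCount q′ b n′ p′ (2 * g)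
fibreCount≡monomialCount b p′ q′ n′ g = trans
  (countᵇ-cong (All-map (λ {X} n≡ → does-⇔ (jumps⇔exponents X n≡) (fibre? _ _ g b X) (exponents? q′ b n′ p′ (2 * g) X))
                        (dipolesHat-classes (suc (b + q′ + n′)))))
  (cong (λ N → countᵇ (λ X → does (exponents? q′ b n′ p′ (2 * g) X)) (dipolesHat N)) (total b q′ n′))
  where
  jumps⇔exponents : ∀ X → 2 + ((αE X + βE X) + (γE X + δE X)) ≡ suc (b + q′ + n′) →
                    (Jumps (suc b + p′) (b + q′) g X × b ≡ βE X) ⇔ Exponents q′ b n′ p′ (2 * g) X
  jumps⇔exponents X n≡ =
    mk⇔ (jumps⇒exponents (ρ≡1+β+δ X) (ν≡1+α+β X) n≡) (exponents⇒jumps (ρ≡1+β+δ X) (ν≡1+α+β X))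
  total : ∀ b q′ n′ → suc (b + q′ + n′) ≡ q′ + b + n′ + 1
  total = solve-∀

ν<n : ∀ {n} X → 2 + ((αE X + βE X) + (γE X + δE X)) ≡ n → ν X < n
ν<n X n≡ = subst₂ _<_ (sym (ν≡1+α+β X)) n≡ (s≤s (s≤s (m≤m+n (αE X + βE X) (γE X + δE X))))

fibreCount-n≤q : ∀ p q n g b → n ≤ q → fibreCount p q n g b ≡ 0
fibreCount-n≤q p q n g b n≤q = countᵇ-none _ (dipolesHat n)
  (All-map (λ {X} n≡ → dec-false (fibre? p q g b X) (λ ((_ , ν≡q , _) , _) →
    <⇒≱ (ν<n X n≡) (subst (n ≤_) (sym ν≡q) n≤q)))
    (dipolesHat-classes n))

fibreCount-q<b : ∀ p q n g b → q < b → fibreCount p q n g b ≡ 0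
fibreCount-q<b p q n g b q<b = countᵇ-none _ (dipolesHat n)
  (universal (λ X → dec-false (fibre? p q g b X) (λ ((_ , ν≡q , _) , b≡β) →
    <-irrefl refl (<-trans q<b (subst₂ _<_ (sym b≡β) (trans (sym (ν≡1+α+β X)) ν≡q) (s≤s (m≤n+m _ _))))))
    (dipolesHat n))

BracketFibre : (p q n g b : ℕ) → Set
BracketFibre p q n g b =
  bracketΓ (+ n -ℤ + q -ℤ + 1) b (p ∸ 1 ∸ b) (+ q -ℤ + b) (2 * g) ≡ ℕtoℚ (fibreCount p q n g b)

bracketFibre-n≤q : ∀ p {q} n g b k → n + k ≡ q → BracketFibre p q n g b
bracketFibre-n≤q p n g b k refl = begin
  bracketΓ (+ n -ℤ + (n + k) -ℤ + 1) b (p ∸ 1 ∸ b) (+ (n + k) -ℤ + b) (2 * g)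
    ≡⟨ cong (λ i → bracketΓ i b (p ∸ 1 ∸ b) (+ (n + k) -ℤ + b) (2 * g))
            (trans (i-[+m]-1≡i-[+[1+m]] (+ n) (n + k)) ([+m]-[+[1+m+n]]≡-[1+n] n k)) ⟩
  0ℚ
    ≡⟨ cong ℕtoℚ (fibreCount-n≤q p (n + k) n g b (m≤m+n n k)) ⟨
  ℕtoℚ (fibreCount p (n + k) n g b) ∎

bracketFibre-q<b : ∀ p {q n b} g n′ k → suc q + n′ ≡ n → suc q + k ≡ b → BracketFibre p q n g b
bracketFibre-q<b p {q} g n′ k refl refl = begin
  bracketΓ (+ suc (q + n′) -ℤ + q -ℤ + 1) b (p ∸ 1 ∸ b) (+ q -ℤ + b) (2 * g)
    ≡⟨ cong₂ (λ i j → bracketΓ i b (p ∸ 1 ∸ b) j (2 * g))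
             (trans (i-[+m]-1≡i-[+[1+m]] (+ suc (q + n′)) q) ([+[m+n]]-[+m]≡+n (suc q) n′))
             ([+m]-[+[1+m+n]]≡-[1+n] q k) ⟩
  0ℚ
    ≡⟨ cong ℕtoℚ (fibreCount-q<b p q (suc (q + n′)) g b (s≤s (m≤m+n q k))) ⟨
  ℕtoℚ (fibreCount p q (suc (q + n′)) g b) ∎
  where
  b = suc (q + k)

bracketFibre-b≤q<n : ∀ {p q n} g b p′ q′ n′ → suc b + p′ ≡ p → b + q′ ≡ q → suc q + n′ ≡ n → BracketFibre p q n g b
bracketFibre-b≤q<n g b p′ q′ n′ refl refl refl = begin
  bracketΓ (+ suc (b + q′ + n′) -ℤ + (b + q′) -ℤ + 1) b (suc (b + p′) ∸ 1 ∸ b) (+ (b + q′) -ℤ + b) (2 * g)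
    ≡⟨ cong₂ (λ i j → bracketΓ i b j (+ (b + q′) -ℤ + b) (2 * g))
             (trans (i-[+m]-1≡i-[+[1+m]] (+ suc (b + q′ + n′)) (b + q′)) ([+[m+n]]-[+m]≡+n (suc (b + q′)) n′))
             (m+n∸m≡n b p′) ⟩
  bracketΓ (+ n′) b p′ (+ (b + q′) -ℤ + b) (2 * g)
    ≡⟨ cong (λ j → bracketΓ (+ n′) b p′ j (2 * g)) ([+[m+n]]-[+m]≡+n b q′) ⟩
  bracketΓ (+ n′) b p′ (+ q′) (2 * g)
    ≡⟨ bracketΓ≡monomialCount n′ b p′ q′ (2 * g) ⟩
  ℕtoℚ (monomialCount q′ b n′ p′ (2 * g))
    ≡⟨ cong ℕtoℚ (fibreCount≡monomialCount b p′ q′ n′ g) ⟨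
  ℕtoℚ (fibreCount (suc b + p′) (b + q′) (suc (b + q′ + n′)) g b) ∎

bracketFibre : ∀ p q n g b → b < p → BracketFibre p q n g b
bracketFibre p q n g b b<p = byCases (≤-<-connex n q) (≤-<-connex b q)
  where
  byCases : n ≤ q ⊎ q < n → b ≤ q ⊎ q < b → BracketFibre p q n g b
  byCases (inj₁ n≤q) _ = let k , n+k≡q = m≤n⇒∃[o]m+o≡n n≤q in bracketFibre-n≤q p n g b k n+k≡q
  byCases (inj₂ q<n) (inj₂ q<b) =
    let n′ , n≡ = m≤n⇒∃[o]m+o≡n q<n ; k , b≡ = m≤n⇒∃[o]m+o≡n q<b in bracketFibre-q<b p g n′ k n≡ b≡
  byCases (inj₂ q<n) (inj₁ b≤q) =
    let p′ , p≡ = m≤n⇒∃[o]m+o≡n b<p ; q′ , q≡ = m≤n⇒∃[o]m+o≡n b≤q ; n′ , n≡ = m≤n⇒∃[o]m+o≡n q<n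
    in bracketFibre-b≤q<n g b p′ q′ n′ p≡ q≡ n≡

mainTheorem1 : (p q n g : ℕ) →
    (+ phiCoeff p q n g) / 1
      ≡ sumℚ (map (λ b → bracketΓ ((+ n) -ℤ (+ q) -ℤ (+ 1)) b (p ∸ 1 ∸ b) ((+ q) -ℤ (+ b)) (2 Data.Nat.* g)) (upTo p))
mainTheorem1 p q n g = begin
  ℕtoℚ (phiCoeff p q n g)
    ≡⟨ cong ℕtoℚ (countᵇ-fibres (λ X → does (jumps? p q g X)) βE p (dipolesHat n) β<ρ) ⟩
  ℕtoℚ (sum (map (fibreCount p q n g) (upTo p)))
    ≡⟨ ℕtoℚ-sum (fibreCount p q n g) (upTo p) ⟩
  sumℚ (map (ℕtoℚ ∘ fibreCount p q n g) (upTo p))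
    ≡⟨ cong sumℚ (map-cong-local (applyUpTo⁺₁ (λ b → b) p (λ b<p → sym (bracketFibre p q n g _ b<p)))) ⟩
  sumℚ (map (λ b → bracketΓ (+ n -ℤ + q -ℤ + 1) b (p ∸ 1 ∸ b) (+ q -ℤ + b) (2 * g)) (upTo p)) ∎
  where
  β<ρ : ∀ X → T (does (jumps? p q g X)) → βE X < p
  β<ρ X jumps = subst (βE X <_) (trans (sym (ρ≡1+β+δ X)) (proj₁ (T-does (jumps? p q g X) jumps))) (s≤s (m≤m+n _ _))
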